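{- Let $\alpha=(1-\omega^2)^{k-1}\mu\in\mathbb{Z}[\omega]$ be an even norm-perfect Eisenstein integer with $\mu$ odd and $k\ge 2$ a rational integer. Then $k\equiv \pm 2,\pm 1, 0\pmod{12}$.
   Context: $\omega=e^{2\pi i/3}$, $N(a+b\omega)=a^2-ab+b^2$. Positive primes: $\mathbb{P}^+=\{a+b\omega: a>b\ge 0\}\cap\{\text{primes}\}$. For nonzero $\alpha=\varepsilon\prod\pi_j^{e_j}$ ($\varepsilon$ a unit, distinct $\pi_j\in\mathbb{P}^+$), $\sigma(\alpha)=\prod\frac{\pi_j^{e_j+1}-1}{\pi_j-1}$. Even means divisible by $1-\omega^2$, odd means not. Norm-perfect means $N(\sigma(\alpha))=3N(\alpha)$. -}

module Defs where

open import Data.Nat as ℕ using (ℕ; zero; suc)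
open import Data.Integer as ℤ using (ℤ; +_; 0ℤ; 1ℤ)
open import Data.Product using (Σ; ∃; _×_; _,_; proj₁; proj₂)
open import Data.List using (List; []; _∷_; map; foldr)
open import Data.List.Relation.Unary.All using (All)
open import Data.List.Relation.Unary.Unique.Propositional using (Unique)
open import Relation.Binary.PropositionalEquality using (_≡_)
open import Relation.Nullary using (¬_)
open import Data.Sum using (_⊎_)

-- Eisenstein integer  a + b ω  with ω = e^{2πi/3}, ω² = -1 - ω.
record 𝔼 : Set where
  constructor _+_ω
  field
    a : ℤ
    b : ℤ
open 𝔼 public

infixl 6 _+ᴱ_ _-ᴱ_
infixl 7 _*ᴱ_

_+ᴱ_ : 𝔼 → 𝔼 → 𝔼
(a₁ + b₁ ω) +ᴱ (a₂ + b₂ ω) = (a₁ ℤ.+ a₂) + (b₁ ℤ.+ b₂) ω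

_-ᴱ_ : 𝔼 → 𝔼 → 𝔼
(a₁ + b₁ ω) -ᴱ (a₂ + b₂ ω) = (a₁ ℤ.- a₂) + (b₁ ℤ.- b₂) ω

-- (a+bω)(c+dω) = ac + (ad+bc)ω + bd ω² = (ac - bd) + (ad + bc - bd) ω
_*ᴱ_ : 𝔼 → 𝔼 → 𝔼
(a₁ + b₁ ω) *ᴱ (a₂ + b₂ ω) =
  (a₁ ℤ.* a₂ ℤ.- b₁ ℤ.* b₂) + (a₁ ℤ.* b₂ ℤ.+ b₁ ℤ.* a₂ ℤ.- b₁ ℤ.* b₂) ω

0ᴱ 1ᴱ ωᴱ : 𝔼
0ᴱ = 0ℤ + 0ℤ ω
1ᴱ = 1ℤ + 0ℤ ω
ωᴱ = 0ℤ + 1ℤ ω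

_^ᴱ_ : 𝔼 → ℕ → 𝔼
x ^ᴱ zero = 1ᴱ
x ^ᴱ suc n = x *ᴱ (x ^ᴱ n)

N : 𝔼 → ℤ
N (x + y ω) = x ℤ.* x ℤ.- x ℤ.* y ℤ.+ y ℤ.* y

_∣ᴱ_ : 𝔼 → 𝔼 → Set
x ∣ᴱ y = ∃ λ z → y ≡ x *ᴱ z

IsUnit : 𝔼 → Set
IsUnit u = u ∣ᴱ 1ᴱ

IsPrimeᴱ : 𝔼 → Set
IsPrimeᴱ p = ¬ (p ≡ 0ᴱ) × ¬ IsUnit p ×
  (∀ x y → p ∣ᴱ (x *ᴱ y) → p ∣ᴱ x ⊎ p ∣ᴱ y)

PosPrime : 𝔼 → Set
PosPrime p = IsPrimeᴱ p × (a p ℤ.> b p) × (b p ℤ.≥ 0ℤ)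

λᴱ : 𝔼
λᴱ = 1ᴱ -ᴱ (ωᴱ *ᴱ ωᴱ)

Even Odd : 𝔼 → Set
Even x = λᴱ ∣ᴱ x
Odd x = ¬ Even x

prodᴱ : List 𝔼 → 𝔼
prodᴱ = foldr _*ᴱ_ 1ᴱ

geom : 𝔼 → ℕ → 𝔼
geom p zero = 1ᴱ
geom p (suc e) = geom p e +ᴱ (p ^ᴱ suc e)

-- IsSigma α s : s = σ(α), where α = ε ∏ π_j^{e_j} (ε unit, distinct π_j ∈ ℙ⁺, e_j ≥ 1)
-- and σ(α) = ∏ (π_j^{e_j+1} - 1)/(π_j - 1).
IsSigma : 𝔼 → 𝔼 → Set
IsSigma α s = Σ 𝔼 λ ε → Σ (List (𝔼 × ℕ)) λ fs →
  IsUnit ε ×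
  All (λ pe → PosPrime (proj₁ pe)) fs ×
  All (λ pe → 1 ℕ.≤ proj₂ pe) fs ×
  Unique (map proj₁ fs) ×
  α ≡ ε *ᴱ prodᴱ (map (λ pe → proj₁ pe ^ᴱ proj₂ pe) fs) ×
  s ≡ prodᴱ (map (λ pe → geom (proj₁ pe) (proj₂ pe)) fs)

NormPerfect : 𝔼 → Set
NormPerfect α = ¬ (α ≡ 0ᴱ) × Σ 𝔼 λ s → IsSigma α s × N s ≡ + 3 ℤ.* N α

-- Write λ^(k-1) μ = ε ∏ π^e over distinct positive primes. A positive prime π ≠ λ has norm
-- prime to 3 and trace π + π̄ ≥ 3, and the latter gives N(1 + π + ⋯ + π^e) ≥ N(π^e). Comparing
-- powers of 3 in the norms, λ occurs with exponent k - 1 and the other factors have total norm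
-- N(μ), so 3^k N(μ) = N(σ(α)) ≥ N(λ^k - 1) N(μ). Since N(λ^k - 1) = 3^k - Tr(λ^k) + 1, the trace
-- of λ^k must be positive; as λ¹² = 729, its sign depends only on k mod 12, and it is positive
-- exactly for k ≡ 0, ±1, ±2.

module Submission where

open import Defs
open import Data.Nat using (ℕ; _≤_; _%_; _∸_)
open import Data.Sum using (_⊎_)
open import Relation.Binary.PropositionalEquality using (_≡_)
open import Data.Nat as ℕ using (zero; suc; _<_; z≤n; s≤s; NonZero)
import Data.Nat.Properties as ℕP
open import Algebra.Properties.CommutativeSemigroup ℕP.*-commutativeSemigroup using (x∙yz≈y∙xz)
import Data.Nat.Tactic.RingSolver as ℕ-Solver
open import Data.Nat.Divisibility using (_∣_; _∤_; _∣?_; _∣0; m∣m*n; ∣m⇒∣m*n; ∣1⇒≡1)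
open import Data.Nat.DivMod using (_/_; m%n<n; m≡m%n+[m/n]*n)
open import Data.Nat.Primality using (Prime; prime?; euclidsLemma; ¬prime[1])
open import Data.Integer as ℤ using (ℤ; +_; -[1+_]; 0ℤ; 1ℤ; +≤+; +<+; -≤+)
import Data.Integer.Properties as ℤP
import Data.Integer.Divisibility.Signed as ℤ∣
open import Data.Integer.Tactic.RingSolver using (solve-∀)
open import Data.Product using (∃₂; _×_; _,_; proj₁; proj₂)
open import Data.Sum using (inj₁; inj₂; [_,_]′; reduce)
open import Data.List using (List; []; _∷_; map)
open import Data.List.Relation.Unary.All as All using (All; []; _∷_)
open import Data.List.Relation.Unary.Any using (here; there)
open import Data.List.Relation.Unary.AllPairs using ([]; _∷_)
open import Data.List.Relation.Unary.Unique.Propositional using (Unique)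
open import Data.List.Membership.Propositional using (_∈_)
open import Function using (_∘_)
open import Relation.Nullary using (¬_; yes; no; contradiction)
open import Relation.Nullary.Decidable using (from-yes)
open import Relation.Binary.PropositionalEquality
  using (_≢_; refl; sym; trans; cong; cong₂; subst; subst₂; module ≡-Reasoning)

*-identityˡ : ∀ x → 1ᴱ *ᴱ x ≡ x
*-identityˡ (a + b ω) = cong₂ _+_ω (re a b) (im a b)
  where
  re : ∀ a b → 1ℤ ℤ.* a ℤ.- 0ℤ ℤ.* b ≡ a
  re = solve-∀
  im : ∀ a b → 1ℤ ℤ.* b ℤ.+ 0ℤ ℤ.* a ℤ.- 0ℤ ℤ.* b ≡ b
  im = solve-∀

*-identityʳ : ∀ x → x *ᴱ 1ᴱ ≡ x
*-identityʳ (a + b ω) = cong₂ _+_ω (re a b) (im a b)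
  where
  re : ∀ a b → a ℤ.* 1ℤ ℤ.- b ℤ.* 0ℤ ≡ a
  re = solve-∀
  im : ∀ a b → a ℤ.* 0ℤ ℤ.+ b ℤ.* 1ℤ ℤ.- b ℤ.* 0ℤ ≡ b
  im = solve-∀

*-assoc : ∀ x y z → (x *ᴱ y) *ᴱ z ≡ x *ᴱ (y *ᴱ z)
*-assoc (a + b ω) (c + d ω) (e + f ω) = cong₂ _+_ω (re a b c d e f) (im a b c d e f)
  where
  re : ∀ a b c d e f →
    (a ℤ.* c ℤ.- b ℤ.* d) ℤ.* e ℤ.- (a ℤ.* d ℤ.+ b ℤ.* c ℤ.- b ℤ.* d) ℤ.* f
    ≡ a ℤ.* (c ℤ.* e ℤ.- d ℤ.* f) ℤ.- b ℤ.* (c ℤ.* f ℤ.+ d ℤ.* e ℤ.- d ℤ.* f)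
  re = solve-∀
  im : ∀ a b c d e f →
    (a ℤ.* c ℤ.- b ℤ.* d) ℤ.* f ℤ.+ (a ℤ.* d ℤ.+ b ℤ.* c ℤ.- b ℤ.* d) ℤ.* e
      ℤ.- (a ℤ.* d ℤ.+ b ℤ.* c ℤ.- b ℤ.* d) ℤ.* f
    ≡ a ℤ.* (c ℤ.* f ℤ.+ d ℤ.* e ℤ.- d ℤ.* f) ℤ.+ b ℤ.* (c ℤ.* e ℤ.- d ℤ.* f)
      ℤ.- b ℤ.* (c ℤ.* f ℤ.+ d ℤ.* e ℤ.- d ℤ.* f)
  im = solve-∀

*-distribʳ-+ : ∀ x y z → (y +ᴱ z) *ᴱ x ≡ y *ᴱ x +ᴱ z *ᴱ x
*-distribʳ-+ (a + b ω) (c + d ω) (e + f ω) = cong₂ _+_ω (re a b c d e f) (im a b c d e f)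
  where
  re : ∀ a b c d e f →
    (c ℤ.+ e) ℤ.* a ℤ.- (d ℤ.+ f) ℤ.* b ≡ (c ℤ.* a ℤ.- d ℤ.* b) ℤ.+ (e ℤ.* a ℤ.- f ℤ.* b)
  re = solve-∀
  im : ∀ a b c d e f →
    (c ℤ.+ e) ℤ.* b ℤ.+ (d ℤ.+ f) ℤ.* a ℤ.- (d ℤ.+ f) ℤ.* b
    ≡ (c ℤ.* b ℤ.+ d ℤ.* a ℤ.- d ℤ.* b) ℤ.+ (e ℤ.* b ℤ.+ f ℤ.* a ℤ.- f ℤ.* b)
  im = solve-∀

^ᴱ-distribˡ-+-* : ∀ x m n → x ^ᴱ (m ℕ.+ n) ≡ x ^ᴱ m *ᴱ x ^ᴱ n
^ᴱ-distribˡ-+-* x zero    n = sym (*-identityˡ _)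
^ᴱ-distribˡ-+-* x (suc m) n =
  trans (cong (x *ᴱ_) (^ᴱ-distribˡ-+-* x m n)) (sym (*-assoc x _ _))

geom-telescope : ∀ π e → geom π e *ᴱ (π -ᴱ 1ᴱ) ≡ π ^ᴱ suc e -ᴱ 1ᴱ
geom-telescope (a + b ω) zero = cong₂ _+_ω (re a b) (im a b)
  where
  re : ∀ a b → 1ℤ ℤ.* (a ℤ.- 1ℤ) ℤ.- 0ℤ ℤ.* (b ℤ.- 0ℤ) ≡ (a ℤ.* 1ℤ ℤ.- b ℤ.* 0ℤ) ℤ.- 1ℤ
  re = solve-∀
  im : ∀ a b → 1ℤ ℤ.* (b ℤ.- 0ℤ) ℤ.+ 0ℤ ℤ.* (a ℤ.- 1ℤ) ℤ.- 0ℤ ℤ.* (b ℤ.- 0ℤ)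
               ≡ (a ℤ.* 0ℤ ℤ.+ b ℤ.* 1ℤ ℤ.- b ℤ.* 0ℤ) ℤ.- 0ℤ
  im = solve-∀
geom-telescope π (suc e) = begin
  (geom π e +ᴱ π ^ᴱ suc e) *ᴱ (π -ᴱ 1ᴱ)            ≡⟨ *-distribʳ-+ (π -ᴱ 1ᴱ) (geom π e) _ ⟩
  geom π e *ᴱ (π -ᴱ 1ᴱ) +ᴱ π ^ᴱ suc e *ᴱ (π -ᴱ 1ᴱ) ≡⟨ cong (_+ᴱ π ^ᴱ suc e *ᴱ (π -ᴱ 1ᴱ)) (geom-telescope π e) ⟩
  π ^ᴱ suc e -ᴱ 1ᴱ +ᴱ π ^ᴱ suc e *ᴱ (π -ᴱ 1ᴱ)      ≡⟨ step (π ^ᴱ suc e) π ⟩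
  π *ᴱ π ^ᴱ suc e -ᴱ 1ᴱ                             ∎
  where
  open ≡-Reasoning
  step : ∀ q p → q -ᴱ 1ᴱ +ᴱ q *ᴱ (p -ᴱ 1ᴱ) ≡ p *ᴱ q -ᴱ 1ᴱ
  step (a + b ω) (c + d ω) = cong₂ _+_ω (re a b c d) (im a b c d)
    where
    re : ∀ a b c d →
      (a ℤ.- 1ℤ) ℤ.+ (a ℤ.* (c ℤ.- 1ℤ) ℤ.- b ℤ.* (d ℤ.- 0ℤ)) ≡ (c ℤ.* a ℤ.- d ℤ.* b) ℤ.- 1ℤ
    re = solve-∀
    im : ∀ a b c d →
      (b ℤ.- 0ℤ) ℤ.+ (a ℤ.* (d ℤ.- 0ℤ) ℤ.+ b ℤ.* (c ℤ.- 1ℤ) ℤ.- b ℤ.* (d ℤ.- 0ℤ))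
      ≡ (c ℤ.* b ℤ.+ d ℤ.* a ℤ.- d ℤ.* b) ℤ.- 0ℤ
    im = solve-∀

-- Tr x = x + x̄, as ω̄ = ω² = -1 - ω.
Tr : 𝔼 → ℤ
Tr (a + b ω) = + 2 ℤ.* a ℤ.- b

‖_‖ : 𝔼 → ℕ
‖ x ‖ = ℤ.∣ N x ∣

N-* : ∀ x y → N (x *ᴱ y) ≡ N x ℤ.* N y
N-* (a + b ω) (c + d ω) = lemma a b c d
  where
  lemma : ∀ a b c d → let x = a ℤ.* c ℤ.- b ℤ.* d ; y = a ℤ.* d ℤ.+ b ℤ.* c ℤ.- b ℤ.* d in
    x ℤ.* x ℤ.- x ℤ.* y ℤ.+ y ℤ.* y
    ≡ (a ℤ.* a ℤ.- a ℤ.* b ℤ.+ b ℤ.* b) ℤ.* (c ℤ.* c ℤ.- c ℤ.* d ℤ.+ d ℤ.* d)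
  lemma = solve-∀

N[x-1] : ∀ x → N (x -ᴱ 1ᴱ) ≡ N x ℤ.- Tr x ℤ.+ 1ℤ
N[x-1] (a + b ω) = lemma a b
  where
  lemma : ∀ a b →
    (a ℤ.- 1ℤ) ℤ.* (a ℤ.- 1ℤ) ℤ.- (a ℤ.- 1ℤ) ℤ.* (b ℤ.- 0ℤ) ℤ.+ (b ℤ.- 0ℤ) ℤ.* (b ℤ.- 0ℤ)
    ≡ (a ℤ.* a ℤ.- a ℤ.* b ℤ.+ b ℤ.* b) ℤ.- (+ 2 ℤ.* a ℤ.- b) ℤ.+ 1ℤ
  lemma = solve-∀

i*i≡+∣i∣*∣i∣ : ∀ i → i ℤ.* i ≡ + (ℤ.∣ i ∣ ℕ.* ℤ.∣ i ∣)
i*i≡+∣i∣*∣i∣ (+ n)    = ℤP.+◃n≡+n (n ℕ.* n)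
i*i≡+∣i∣*∣i∣ -[1+ n ] = refl

4N≡Tr²+3b² : ∀ x → + 4 ℤ.* N x ≡ + (ℤ.∣ Tr x ∣ ℕ.* ℤ.∣ Tr x ∣ ℕ.+ 3 ℕ.* (ℤ.∣ b x ∣ ℕ.* ℤ.∣ b x ∣))
4N≡Tr²+3b² (a + b ω) = begin
  + 4 ℤ.* (a ℤ.* a ℤ.- a ℤ.* b ℤ.+ b ℤ.* b)    ≡⟨ lemma a b ⟩
  t ℤ.* t ℤ.+ + 3 ℤ.* (b ℤ.* b)                ≡⟨ cong₂ ℤ._+_ (i*i≡+∣i∣*∣i∣ t) (cong (+ 3 ℤ.*_) (i*i≡+∣i∣*∣i∣ b)) ⟩
  + (ℤ.∣ t ∣ ℕ.* ℤ.∣ t ∣) ℤ.+ + 3 ℤ.* + (ℤ.∣ b ∣ ℕ.* ℤ.∣ b ∣)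
    ≡⟨ cong (λ z → + (ℤ.∣ t ∣ ℕ.* ℤ.∣ t ∣) ℤ.+ z) (sym (ℤP.pos-* 3 (ℤ.∣ b ∣ ℕ.* ℤ.∣ b ∣))) ⟩
  + (ℤ.∣ t ∣ ℕ.* ℤ.∣ t ∣ ℕ.+ 3 ℕ.* (ℤ.∣ b ∣ ℕ.* ℤ.∣ b ∣)) ∎
  where
  open ≡-Reasoning
  t = + 2 ℤ.* a ℤ.- b
  lemma : ∀ a b →
    + 4 ℤ.* (a ℤ.* a ℤ.- a ℤ.* b ℤ.+ b ℤ.* b)
    ≡ (+ 2 ℤ.* a ℤ.- b) ℤ.* (+ 2 ℤ.* a ℤ.- b) ℤ.+ + 3 ℤ.* (b ℤ.* b)
  lemma = solve-∀

N≡+‖‖ : ∀ x → N x ≡ + ‖ x ‖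
N≡+‖‖ x = nonneg (N x) (4N≡Tr²+3b² x)
  where
  nonneg : ∀ i {n} → + 4 ℤ.* i ≡ + n → i ≡ + ℤ.∣ i ∣
  nonneg (+ _)    _  = refl
  nonneg -[1+ _ ] ()

4‖‖≡∣Tr∣²+3∣b∣² : ∀ x → 4 ℕ.* ‖ x ‖ ≡ ℤ.∣ Tr x ∣ ℕ.* ℤ.∣ Tr x ∣ ℕ.+ 3 ℕ.* (ℤ.∣ b x ∣ ℕ.* ℤ.∣ b x ∣)
4‖‖≡∣Tr∣²+3∣b∣² x = ℤP.+-injective (begin
  + (4 ℕ.* ‖ x ‖)    ≡⟨ ℤP.pos-* 4 ‖ x ‖ ⟩
  + 4 ℤ.* + ‖ x ‖    ≡⟨ cong (+ 4 ℤ.*_) (sym (N≡+‖‖ x)) ⟩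
  + 4 ℤ.* N x        ≡⟨ 4N≡Tr²+3b² x ⟩
  _                  ∎)
  where open ≡-Reasoning

‖‖-* : ∀ x y → ‖ x *ᴱ y ‖ ≡ ‖ x ‖ ℕ.* ‖ y ‖
‖‖-* x y = trans (cong ℤ.∣_∣ (N-* x y)) (ℤP.abs-* (N x) (N y))

‖‖-^ : ∀ x e → ‖ x ^ᴱ e ‖ ≡ ‖ x ‖ ℕ.^ e
‖‖-^ x zero    = refl
‖‖-^ x (suc e) = trans (‖‖-* x (x ^ᴱ e)) (cong (‖ x ‖ ℕ.*_) (‖‖-^ x e))

‖unit‖≡1 : ∀ u → IsUnit u → ‖ u ‖ ≡ 1
‖unit‖≡1 u (v , 1≡uv) = ℕP.m*n≡1⇒m≡1 ‖ u ‖ ‖ v ‖ (sym (trans (cong ‖_‖ 1≡uv) (‖‖-* u v)))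

∤-* : ∀ {p m n} → Prime p → p ∤ m → p ∤ n → p ∤ m ℕ.* n
∤-* {m = m} {n} p-prime p∤m p∤n p∣mn = [ p∤m , p∤n ]′ (euclidsLemma m n p-prime p∣mn)

∤-^ : ∀ {p m} → Prime p → p ∤ m → ∀ e → p ∤ m ℕ.^ e
∤-^ p-prime p∤m zero    p∣1 = ¬prime[1] (subst Prime (∣1⇒≡1 p∣1) p-prime)
∤-^ p-prime p∤m (suc e) = ∤-* p-prime p∤m (∤-^ p-prime p∤m e)

p^i*m≡p^j*n⇒i≡j : ∀ {p} .{{_ : NonZero p}} i j {m n} →
  p ℕ.^ i ℕ.* m ≡ p ℕ.^ j ℕ.* n → p ∤ m → p ∤ n → i ≡ j
p^i*m≡p^j*n⇒i≡j zero    zero    _ _ _ = refl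
p^i*m≡p^j*n⇒i≡j {p} zero (suc j) {m} {n} eq p∤m _ =
  contradiction (subst (p ∣_) (trans (sym eq) (ℕP.*-identityˡ m)) (∣m⇒∣m*n n (m∣m*n (p ℕ.^ j)))) p∤m
p^i*m≡p^j*n⇒i≡j (suc i) zero    eq p∤m p∤n = sym (p^i*m≡p^j*n⇒i≡j zero (suc i) (sym eq) p∤n p∤m)
p^i*m≡p^j*n⇒i≡j {p} (suc i) (suc j) {m} {n} eq p∤m p∤n =
  cong suc (p^i*m≡p^j*n⇒i≡j i j (ℕP.*-cancelˡ-≡ _ _ p
    (trans (sym (ℕP.*-assoc p _ m)) (trans eq (ℕP.*-assoc p _ n)))) p∤m p∤n)

prime[3] : Prime 3
prime[3] = from-yes (prime? 3)

-- 3 ∣ N(a + bω) = (a + b)² - 3ab forces a + b = 3q, and then a + bω = λ (q + (b - q) ω).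
3∣‖x‖⇒λ∣x : ∀ x → 3 ∣ ‖ x ‖ → λᴱ ∣ᴱ x
3∣‖x‖⇒λ∣x (a + b ω) 3∣‖x‖ with 3∣a+b
  where
  3∣a+b : + 3 ℤ∣.∣ a ℤ.+ b
  3∣a+b = ℤ∣.∣ᵤ⇒∣ (reduce (euclidsLemma _ _ prime[3]
    (subst (3 ∣_) (ℤP.abs-* (a ℤ.+ b) (a ℤ.+ b)) (ℤ∣.∣⇒∣ᵤ 3∣[a+b]²))))
    where
    square : ∀ a b → (a ℤ.+ b) ℤ.* (a ℤ.+ b) ≡ (a ℤ.* a ℤ.- a ℤ.* b ℤ.+ b ℤ.* b) ℤ.+ + 3 ℤ.* (a ℤ.* b)
    square = solve-∀
    3∣[a+b]² : + 3 ℤ∣.∣ (a ℤ.+ b) ℤ.* (a ℤ.+ b)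
    3∣[a+b]² = subst (+ 3 ℤ∣.∣_) (sym (square a b))
      (ℤ∣.∣m∣n⇒∣m+n (ℤ∣.∣ᵤ⇒∣ {+ 3} {N (a + b ω)} 3∣‖x‖) (ℤ∣.∣m⇒∣m*n (a ℤ.* b) ℤ∣.∣-refl))
... | ℤ∣.divides q a+b≡q*3 = q + (b ℤ.- q) ω , cong₂ _+_ω re (im b q)
  where
  re : a ≡ + 2 ℤ.* q ℤ.- 1ℤ ℤ.* (b ℤ.- q)
  re = begin
    a                      ≡⟨ l₁ a b ⟩
    (a ℤ.+ b) ℤ.- b        ≡⟨ cong (ℤ._- b) a+b≡q*3 ⟩
    q ℤ.* + 3 ℤ.- b        ≡⟨ l₂ q b ⟩
    + 2 ℤ.* q ℤ.- 1ℤ ℤ.* (b ℤ.- q) ∎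
    where
    open ≡-Reasoning
    l₁ : ∀ a b → a ≡ (a ℤ.+ b) ℤ.- b
    l₁ = solve-∀
    l₂ : ∀ q b → q ℤ.* + 3 ℤ.- b ≡ + 2 ℤ.* q ℤ.- 1ℤ ℤ.* (b ℤ.- q)
    l₂ = solve-∀
  im : ∀ b q → b ≡ + 2 ℤ.* (b ℤ.- q) ℤ.+ 1ℤ ℤ.* q ℤ.- 1ℤ ℤ.* (b ℤ.- q)
  im = solve-∀

m≡m*n⇒n≡1 : ∀ m n .{{_ : NonZero m}} → m ≡ m ℕ.* n → n ≡ 1
m≡m*n⇒n≡1 m n eq = sym (ℕP.*-cancelˡ-≡ 1 n m (trans (ℕP.*-identityʳ m) eq))

‖π‖≡‖x‖ : ∀ {x π} → IsPrimeᴱ π → ‖ π ‖ ≢ 0 → ‖ x ‖ ≢ 1 → x ∣ᴱ π → ‖ π ‖ ≡ ‖ x ‖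
‖π‖≡‖x‖ {x} {π} (_ , _ , prime) ‖π‖≢0 ‖x‖≢1 (u , π≡xu)
  with prime x u (1ᴱ , trans (sym π≡xu) (sym (*-identityʳ π)))
... | inj₁ (v , x≡πv) = begin
  ‖ π ‖            ≡⟨ ‖π‖≡‖x‖‖u‖ ⟩
  ‖ x ‖ ℕ.* ‖ u ‖  ≡⟨ cong (‖ x ‖ ℕ.*_) (ℕP.m*n≡1⇒m≡1 ‖ u ‖ ‖ v ‖ ‖u‖‖v‖≡1) ⟩
  ‖ x ‖ ℕ.* 1      ≡⟨ ℕP.*-identityʳ ‖ x ‖ ⟩
  ‖ x ‖            ∎
  where
  open ≡-Reasoning
  ‖π‖≡‖x‖‖u‖ = trans (cong ‖_‖ π≡xu) (‖‖-* x u)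
  instance
    ‖x‖≢0 : NonZero ‖ x ‖
    ‖x‖≢0 = ℕ.≢-nonZero (λ ‖x‖≡0 → ‖π‖≢0 (trans ‖π‖≡‖x‖‖u‖ (cong (ℕ._* ‖ u ‖) ‖x‖≡0)))
  ‖u‖‖v‖≡1 : ‖ u ‖ ℕ.* ‖ v ‖ ≡ 1
  ‖u‖‖v‖≡1 = m≡m*n⇒n≡1 ‖ x ‖ _ (begin
    ‖ x ‖                        ≡⟨ trans (cong ‖_‖ x≡πv) (‖‖-* π v) ⟩
    ‖ π ‖ ℕ.* ‖ v ‖              ≡⟨ cong (ℕ._* ‖ v ‖) ‖π‖≡‖x‖‖u‖ ⟩
    ‖ x ‖ ℕ.* ‖ u ‖ ℕ.* ‖ v ‖    ≡⟨ ℕP.*-assoc ‖ x ‖ _ _ ⟩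
    ‖ x ‖ ℕ.* (‖ u ‖ ℕ.* ‖ v ‖)  ∎)
... | inj₂ (v , u≡πv) = contradiction (ℕP.m*n≡1⇒m≡1 ‖ x ‖ ‖ v ‖ ‖x‖‖v‖≡1) ‖x‖≢1
  where
  open ≡-Reasoning
  instance
    ‖π‖≢0′ : NonZero ‖ π ‖
    ‖π‖≢0′ = ℕ.≢-nonZero ‖π‖≢0
  ‖x‖‖v‖≡1 : ‖ x ‖ ℕ.* ‖ v ‖ ≡ 1
  ‖x‖‖v‖≡1 = m≡m*n⇒n≡1 ‖ π ‖ _ (begin
    ‖ π ‖                        ≡⟨ trans (cong ‖_‖ π≡xu) (‖‖-* x u) ⟩
    ‖ x ‖ ℕ.* ‖ u ‖              ≡⟨ cong (‖ x ‖ ℕ.*_) (trans (cong ‖_‖ u≡πv) (‖‖-* π v)) ⟩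
    ‖ x ‖ ℕ.* (‖ π ‖ ℕ.* ‖ v ‖)  ≡⟨ x∙yz≈y∙xz (‖ x ‖) (‖ π ‖) (‖ v ‖) ⟩
    ‖ π ‖ ℕ.* (‖ x ‖ ℕ.* ‖ v ‖)  ∎)

positive : ℕ → ℕ → 𝔼
positive n w = (+ suc (n ℕ.+ w)) + (+ n) ω

positive-form : ∀ {π} → a π ℤ.> b π → b π ℤ.≥ 0ℤ → ∃₂ λ n w → π ≡ positive n w
positive-form {.(+ m) + .(+ n) ω} (+<+ {n} {m} n<m) (+≤+ _) with ℕP.m≤n⇒∃[o]m+o≡n n<m
... | w , refl = n , w , refl

‖positive‖ : ∀ n w → ‖ positive n w ‖ ≡ suc (n ℕ.+ w) ℕ.* suc w ℕ.+ n ℕ.* n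
‖positive‖ n w = cong ℤ.∣_∣ (trans (lemma (+ n) (+ w))
  (cong₂ ℤ._+_ (sym (ℤP.pos-* (suc (n ℕ.+ w)) (suc w))) (sym (ℤP.pos-* n n))))
  where
  lemma : ∀ n w → let a = 1ℤ ℤ.+ (n ℤ.+ w) in
    a ℤ.* a ℤ.- a ℤ.* n ℤ.+ n ℤ.* n ≡ a ℤ.* (1ℤ ℤ.+ w) ℤ.+ n ℤ.* n
  lemma = solve-∀

Tr-positive : ∀ n w → Tr (positive n w) ≡ + (2 ℕ.+ n ℕ.+ (w ℕ.+ w))
Tr-positive n w = lemma (+ n) (+ w)
  where
  lemma : ∀ n w → + 2 ℤ.* (1ℤ ℤ.+ (n ℤ.+ w)) ℤ.- n ≡ + 2 ℤ.+ n ℤ.+ (w ℤ.+ w)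
  lemma = solve-∀

‖positive‖≡3⇒λ : ∀ n w → ‖ positive n w ‖ ≡ 3 → positive n w ≡ λᴱ
‖positive‖≡3⇒λ n w ‖π‖≡3 with trans (sym (‖positive‖ n w)) ‖π‖≡3
‖positive‖≡3⇒λ zero          zero    _ | ()
‖positive‖≡3⇒λ (suc zero)    zero    _ | _  = refl
‖positive‖≡3⇒λ (suc (suc n)) zero    _ | eq = contradiction (subst (4 ≤_) eq 4≤) (ℕP.<⇒≱ (ℕP.n<1+n 3))
  where
  4≤ : 4 ≤ suc (suc (suc n) ℕ.+ 0) ℕ.* 1 ℕ.+ suc (suc n) ℕ.* suc (suc n)
  4≤ = ℕP.≤-trans (ℕP.*-mono-≤ {2} {suc (suc n)} {2} {suc (suc n)} (s≤s (s≤s z≤n)) (s≤s (s≤s z≤n)))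
                   (ℕP.m≤n+m (suc (suc n) ℕ.* suc (suc n)) (suc (suc (suc n) ℕ.+ 0) ℕ.* 1))
‖positive‖≡3⇒λ n             (suc w) _ | eq = contradiction (subst (4 ≤_) eq 4≤) (ℕP.<⇒≱ (ℕP.n<1+n 3))
  where
  4≤ : 4 ≤ suc (n ℕ.+ suc w) ℕ.* suc (suc w) ℕ.+ n ℕ.* n
  4≤ = ℕP.≤-trans
    (ℕP.*-mono-≤ {2} {suc (n ℕ.+ suc w)} {2} {suc (suc w)}
      (s≤s (ℕP.≤-trans (s≤s z≤n) (ℕP.m≤n+m (suc w) n))) (s≤s (s≤s z≤n)))
    (ℕP.m≤m+n (suc (n ℕ.+ suc w) ℕ.* suc (suc w)) (n ℕ.* n))

PosPrime⇒3≤Tr : ∀ {π} → PosPrime π → + 3 ℤ.≤ Tr π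
PosPrime⇒3≤Tr ((_ , not-unit , _) , a>b , b≥0) with positive-form a>b b≥0
... | zero  , zero  , refl = contradiction (1ᴱ , refl) not-unit
... | suc n , w     , refl = subst (+ 3 ℤ.≤_) (sym (Tr-positive (suc n) w)) (+≤+ (s≤s (s≤s (s≤s z≤n))))
... | zero  , suc w , refl = subst (+ 3 ℤ.≤_) (sym (Tr-positive zero (suc w))) (+≤+ (s≤s (s≤s (s≤s z≤n))))

PosPrime⇒≡λ⊎3∤‖‖ : ∀ {π} → PosPrime π → π ≡ λᴱ ⊎ 3 ∤ ‖ π ‖
PosPrime⇒≡λ⊎3∤‖‖ {π} (prime , a>b , b≥0) with 3 ∣? ‖ π ‖ | positive-form a>b b≥0
... | no 3∤‖π‖ | _              = inj₂ 3∤‖π‖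
... | yes 3∣‖π‖ | n , w , refl = inj₁ (‖positive‖≡3⇒λ n w
  (‖π‖≡‖x‖ {λᴱ} prime ‖π‖≢0 (λ ()) (3∣‖x‖⇒λ∣x (positive n w) 3∣‖π‖)))
  where
  ‖π‖≢0 : ‖ positive n w ‖ ≢ 0
  ‖π‖≢0 eq with trans (sym (‖positive‖ n w)) eq
  ... | ()

m*m≤n*n⇒m≤n : ∀ {m n} → m ℕ.* m ≤ n ℕ.* n → m ≤ n
m*m≤n*n⇒m≤n m*m≤n*n = ℕP.≮⇒≥ (λ n<m → ℕP.<⇒≱ (ℕP.*-mono-< n<m n<m) m*m≤n*n)

m≤m^[1+n] : ∀ m n → m ≤ m ℕ.^ suc n
m≤m^[1+n] zero      n = z≤n
m≤m^[1+n] m@(suc _) n = ℕP.m≤m*n m (m ℕ.^ n) {{ℕP.m^n≢0 m n}}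

‖x‖≤m²⇒Tr≤2m : ∀ x {m} → ‖ x ‖ ≤ m ℕ.* m → Tr x ℤ.≤ + (2 ℕ.* m)
‖x‖≤m²⇒Tr≤2m x {m} ‖x‖≤m² with Tr x | 4‖‖≡∣Tr∣²+3∣b∣² x
... | -[1+ _ ] | _      = -≤+
... | + t      | 4‖x‖≡ = +≤+ (m*m≤n*n⇒m≤n (begin
  t ℕ.* t                                    ≤⟨ ℕP.m≤m+n (t ℕ.* t) _ ⟩
  t ℕ.* t ℕ.+ 3 ℕ.* (ℤ.∣ b x ∣ ℕ.* ℤ.∣ b x ∣) ≡⟨ sym 4‖x‖≡ ⟩
  4 ℕ.* ‖ x ‖                                ≤⟨ ℕP.*-monoʳ-≤ 4 ‖x‖≤m² ⟩
  4 ℕ.* (m ℕ.* m)                            ≡⟨ square m ⟩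
  2 ℕ.* m ℕ.* (2 ℕ.* m)                      ∎))
  where
  open ℕP.≤-Reasoning
  square : ∀ m → 4 ℕ.* (m ℕ.* m) ≡ 2 ℕ.* m ℕ.* (2 ℕ.* m)
  square = ℕ-Solver.solve-∀

-- (N(1 + ⋯ + π^e) - N(π^e)) N(π - 1) = N(π^e) (Tr π - 1) - Tr(π^(e+1)) + 1, which is positive
-- because Tr(π^(e+1)) ≤ 2 √N(π^(e+1)) ≤ 2 N(π^e).
‖π^e‖≤‖geom‖ : ∀ π e → + 3 ℤ.≤ Tr π → ‖ π ^ᴱ e ‖ ≤ ‖ geom π e ‖
‖π^e‖≤‖geom‖ π zero    _   = ℕP.≤-refl
‖π^e‖≤‖geom‖ π (suc e) 3≤t = ℕP.<⇒≤ (ℤP.drop‿+<+ (ℤP.*-cancelʳ-<-nonNeg (+ D) XD<GD))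
  where
  n X G D : ℕ
  n = ‖ π ‖
  X = ‖ π ^ᴱ suc e ‖
  G = ‖ geom π (suc e) ‖
  D = ‖ π -ᴱ 1ᴱ ‖
  t T : ℤ
  t = Tr π
  T = Tr (π ^ᴱ suc (suc e))

  GD≡ : + G ℤ.* + D ≡ + n ℤ.* + X ℤ.- T ℤ.+ 1ℤ
  GD≡ = begin
    + G ℤ.* + D                         ≡⟨ cong₂ ℤ._*_ (N≡+‖‖ (geom π (suc e))) (N≡+‖‖ (π -ᴱ 1ᴱ)) ⟨
    N (geom π (suc e)) ℤ.* N (π -ᴱ 1ᴱ)  ≡⟨ sym (N-* (geom π (suc e)) (π -ᴱ 1ᴱ)) ⟩
    N (geom π (suc e) *ᴱ (π -ᴱ 1ᴱ))     ≡⟨ cong N (geom-telescope π (suc e)) ⟩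
    N (π ^ᴱ suc (suc e) -ᴱ 1ᴱ)          ≡⟨ N[x-1] (π ^ᴱ suc (suc e)) ⟩
    N (π *ᴱ π ^ᴱ suc e) ℤ.- T ℤ.+ 1ℤ    ≡⟨ cong (λ z → z ℤ.- T ℤ.+ 1ℤ) N[π^[1+e]]≡ ⟩
    + n ℤ.* + X ℤ.- T ℤ.+ 1ℤ            ∎
    where
    open ≡-Reasoning
    N[π^[1+e]]≡ : N (π *ᴱ π ^ᴱ suc e) ≡ + n ℤ.* + X
    N[π^[1+e]]≡ = trans (N-* π (π ^ᴱ suc e)) (cong₂ ℤ._*_ (N≡+‖‖ π) (N≡+‖‖ (π ^ᴱ suc e)))

  D≡ : + D ≡ + n ℤ.- t ℤ.+ 1ℤ
  D≡ = trans (sym (N≡+‖‖ (π -ᴱ 1ᴱ))) (trans (N[x-1] π) (cong (λ z → z ℤ.- t ℤ.+ 1ℤ) (N≡+‖‖ π)))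

  T≤X[t-1] : T ℤ.≤ + X ℤ.* (t ℤ.- 1ℤ)
  T≤X[t-1] = begin
    T                     ≤⟨ ‖x‖≤m²⇒Tr≤2m (π ^ᴱ suc (suc e)) {X} ‖P‖≤X² ⟩
    + (2 ℕ.* X)           ≡⟨ trans (cong +_ (ℕP.*-comm 2 X)) (ℤP.pos-* X 2) ⟩
    + X ℤ.* + 2           ≤⟨ ℤP.*-monoˡ-≤-nonNeg (+ X) (ℤP.+-monoˡ-≤ (ℤ.- 1ℤ) 3≤t) ⟩
    + X ℤ.* (t ℤ.- 1ℤ)    ∎
    where
    open ℤP.≤-Reasoning
    ‖P‖≤X² : ‖ π ^ᴱ suc (suc e) ‖ ≤ X ℕ.* X
    ‖P‖≤X² = subst (ℕ._≤ X ℕ.* X) (sym (‖‖-* π (π ^ᴱ suc e)))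
      (ℕP.*-monoˡ-≤ X (subst (n ≤_) (sym (‖‖-^ π (suc e))) (m≤m^[1+n] n e)))

  slack : + G ℤ.* + D ℤ.- (1ℤ ℤ.+ + X ℤ.* + D) ≡ + X ℤ.* (t ℤ.- 1ℤ) ℤ.- T
  slack = begin
    + G ℤ.* + D ℤ.- (1ℤ ℤ.+ + X ℤ.* + D)
      ≡⟨ cong₂ (λ gd d → gd ℤ.- (1ℤ ℤ.+ + X ℤ.* d)) GD≡ D≡ ⟩
    (+ n ℤ.* + X ℤ.- T ℤ.+ 1ℤ) ℤ.- (1ℤ ℤ.+ + X ℤ.* (+ n ℤ.- t ℤ.+ 1ℤ))
      ≡⟨ lemma (+ n) (+ X) t T ⟩
    + X ℤ.* (t ℤ.- 1ℤ) ℤ.- T ∎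
    where
    open ≡-Reasoning
    lemma : ∀ n X t T →
      (n ℤ.* X ℤ.- T ℤ.+ 1ℤ) ℤ.- (1ℤ ℤ.+ X ℤ.* (n ℤ.- t ℤ.+ 1ℤ)) ≡ X ℤ.* (t ℤ.- 1ℤ) ℤ.- T
    lemma = solve-∀

  XD<GD : + X ℤ.* + D ℤ.< + G ℤ.* + D
  XD<GD = ℤP.suc[i]≤j⇒i<j (ℤP.0≤i-j⇒j≤i (subst (0ℤ ℤ.≤_) (sym slack) (ℤP.i≤j⇒0≤j-i T≤X[t-1])))

powers sigmas : List (𝔼 × ℕ) → 𝔼
powers fs = prodᴱ (map (λ pe → proj₁ pe ^ᴱ proj₂ pe) fs)
sigmas fs = prodᴱ (map (λ pe → geom (proj₁ pe) (proj₂ pe)) fs)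

-- In λ-part, λ occurs as λ^e and m is the norm of the product of the other prime powers.
data NormBound (fs : List (𝔼 × ℕ)) : Set where
  λ-free : 3 ∤ ‖ powers fs ‖ → ‖ powers fs ‖ ≤ ‖ sigmas fs ‖ → NormBound fs
  λ-part : ∀ e m → λᴱ ∈ map proj₁ fs → ‖ powers fs ‖ ≡ 3 ℕ.^ e ℕ.* m → 3 ∤ m →
           ‖ geom λᴱ e ‖ ℕ.* m ≤ ‖ sigmas fs ‖ → NormBound fs

normBound : ∀ fs → All (λ pe → PosPrime (proj₁ pe)) fs → Unique (map proj₁ fs) → NormBound fs
normBound [] [] [] = λ-free (λ 3∣1 → contradiction (∣1⇒≡1 3∣1) (λ ())) ℕP.≤-refl
normBound ((π , e) ∷ fs) (π⁺ ∷ fs⁺) (π∉fs ∷ fs-unique) =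
  extend (PosPrime⇒≡λ⊎3∤‖‖ π⁺) (normBound fs fs⁺ fs-unique)
  where
  ‖powers‖ : ‖ powers ((π , e) ∷ fs) ‖ ≡ ‖ π ^ᴱ e ‖ ℕ.* ‖ powers fs ‖
  ‖powers‖ = ‖‖-* (π ^ᴱ e) (powers fs)
  ‖sigmas‖ : ‖ sigmas ((π , e) ∷ fs) ‖ ≡ ‖ geom π e ‖ ℕ.* ‖ sigmas fs ‖
  ‖sigmas‖ = ‖‖-* (geom π e) (sigmas fs)
  π^e≤σ : ‖ π ^ᴱ e ‖ ≤ ‖ geom π e ‖
  π^e≤σ = ‖π^e‖≤‖geom‖ π e (PosPrime⇒3≤Tr π⁺)
  3∤‖π^e‖ : 3 ∤ ‖ π ‖ → 3 ∤ ‖ π ^ᴱ e ‖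
  3∤‖π^e‖ 3∤‖π‖ = subst (3 ∤_) (sym (‖‖-^ π e)) (∤-^ prime[3] 3∤‖π‖ e)

  extend : π ≡ λᴱ ⊎ 3 ∤ ‖ π ‖ → NormBound fs → NormBound ((π , e) ∷ fs)
  extend (inj₁ refl) (λ-free 3∤P P≤S) =
    λ-part e (‖ powers fs ‖) (here refl) (trans ‖powers‖ (cong (ℕ._* ‖ powers fs ‖) (‖‖-^ λᴱ e))) 3∤P
      (subst (‖ geom λᴱ e ‖ ℕ.* ‖ powers fs ‖ ≤_) (sym ‖sigmas‖) (ℕP.*-monoʳ-≤ (‖ geom λᴱ e ‖) P≤S))
  extend (inj₁ refl) (λ-part _ _ λ∈fs _ _ _) = contradiction refl (All.lookup π∉fs λ∈fs)
  extend (inj₂ 3∤‖π‖) (λ-free 3∤P P≤S) =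
    λ-free (subst (3 ∤_) (sym ‖powers‖) (∤-* prime[3] (3∤‖π^e‖ 3∤‖π‖) 3∤P))
           (subst₂ _≤_ (sym ‖powers‖) (sym ‖sigmas‖) (ℕP.*-mono-≤ π^e≤σ P≤S))
  extend (inj₂ 3∤‖π‖) (λ-part e′ m λ∈fs P≡ 3∤m σ-bound) =
    λ-part e′ (‖ π ^ᴱ e ‖ ℕ.* m) (there λ∈fs)
      (trans ‖powers‖ (trans (cong (‖ π ^ᴱ e ‖ ℕ.*_) P≡) (x∙yz≈y∙xz (‖ π ^ᴱ e ‖) (3 ℕ.^ e′) m)))
      (∤-* prime[3] (3∤‖π^e‖ 3∤‖π‖) 3∤m)
      (subst₂ _≤_ (x∙yz≈y∙xz (‖ π ^ᴱ e ‖) (‖ geom λᴱ e′ ‖) m) (sym ‖sigmas‖) (ℕP.*-mono-≤ π^e≤σ σ-bound))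

-- λ - 1 = 1 + ω is a unit.
‖geom-λ‖ : ∀ e → ‖ geom λᴱ e ‖ ≡ ‖ λᴱ ^ᴱ suc e -ᴱ 1ᴱ ‖
‖geom-λ‖ e = begin
  ‖ geom λᴱ e ‖                      ≡⟨ ℕP.*-identityʳ (‖ geom λᴱ e ‖) ⟨
  ‖ geom λᴱ e ‖ ℕ.* ‖ λᴱ -ᴱ 1ᴱ ‖     ≡⟨ ‖‖-* (geom λᴱ e) (λᴱ -ᴱ 1ᴱ) ⟨
  ‖ geom λᴱ e *ᴱ (λᴱ -ᴱ 1ᴱ) ‖        ≡⟨ cong ‖_‖ (geom-telescope λᴱ e) ⟩
  ‖ λᴱ ^ᴱ suc e -ᴱ 1ᴱ ‖              ∎
  where open ≡-Reasoning

normPerfect⇒‖λ^k-1‖≤3^k : ∀ j μ → 3 ∤ ‖ μ ‖ → NormPerfect (λᴱ ^ᴱ suc j *ᴱ μ) →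
  ‖ λᴱ ^ᴱ suc (suc j) -ᴱ 1ᴱ ‖ ≤ 3 ℕ.^ suc (suc j)
normPerfect⇒‖λ^k-1‖≤3^k j μ 3∤‖μ‖ (_ , s , (ε , fs , ε-unit , fs⁺ , _ , fs-unique , α≡ , s≡) , Ns≡3Nα) =
  from-bound (normBound fs fs⁺ fs-unique)
  where
  α = λᴱ ^ᴱ suc j *ᴱ μ

  ‖α‖≡ : ‖ α ‖ ≡ 3 ℕ.^ suc j ℕ.* ‖ μ ‖
  ‖α‖≡ = trans (‖‖-* (λᴱ ^ᴱ suc j) μ) (cong (ℕ._* ‖ μ ‖) (‖‖-^ λᴱ (suc j)))

  ‖powers‖ : ‖ powers fs ‖ ≡ 3 ℕ.^ suc j ℕ.* ‖ μ ‖
  ‖powers‖ = begin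
    ‖ powers fs ‖               ≡⟨ ℕP.*-identityˡ (‖ powers fs ‖) ⟨
    1 ℕ.* ‖ powers fs ‖         ≡⟨ cong (ℕ._* ‖ powers fs ‖) (‖unit‖≡1 ε ε-unit) ⟨
    ‖ ε ‖ ℕ.* ‖ powers fs ‖     ≡⟨ ‖‖-* ε (powers fs) ⟨
    ‖ ε *ᴱ powers fs ‖          ≡⟨ cong ‖_‖ α≡ ⟨
    ‖ α ‖                       ≡⟨ ‖α‖≡ ⟩
    3 ℕ.^ suc j ℕ.* ‖ μ ‖       ∎
    where open ≡-Reasoning

  ‖sigmas‖ : ‖ sigmas fs ‖ ≡ 3 ℕ.^ suc (suc j) ℕ.* ‖ μ ‖
  ‖sigmas‖ = begin
    ‖ sigmas fs ‖               ≡⟨ cong ‖_‖ s≡ ⟨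
    ‖ s ‖                       ≡⟨ cong ℤ.∣_∣ Ns≡3Nα ⟩
    ℤ.∣ + 3 ℤ.* N α ∣           ≡⟨ ℤP.abs-* (+ 3) (N α) ⟩
    3 ℕ.* ‖ α ‖                 ≡⟨ cong (3 ℕ.*_) ‖α‖≡ ⟩
    3 ℕ.* (3 ℕ.^ suc j ℕ.* ‖ μ ‖) ≡⟨ ℕP.*-assoc 3 (3 ℕ.^ suc j) (‖ μ ‖) ⟨
    3 ℕ.^ suc (suc j) ℕ.* ‖ μ ‖ ∎
    where open ≡-Reasoning

  from-bound : NormBound fs → ‖ λᴱ ^ᴱ suc (suc j) -ᴱ 1ᴱ ‖ ≤ 3 ℕ.^ suc (suc j)
  from-bound (λ-free 3∤P _) =
    contradiction (subst (3 ∣_) (sym ‖powers‖) (∣m⇒∣m*n (‖ μ ‖) (m∣m*n (3 ℕ.^ j)))) 3∤P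
  from-bound (λ-part e m _ P≡ 3∤m σ-bound) = ℕP.*-cancelʳ-≤ _ _ m {{m≢0}} (begin
    ‖ λᴱ ^ᴱ suc (suc j) -ᴱ 1ᴱ ‖ ℕ.* m  ≡⟨ cong (ℕ._* m) (‖geom-λ‖ (suc j)) ⟨
    ‖ geom λᴱ (suc j) ‖ ℕ.* m          ≡⟨ cong (λ e → ‖ geom λᴱ e ‖ ℕ.* m) e≡ ⟩
    ‖ geom λᴱ e ‖ ℕ.* m                ≤⟨ σ-bound ⟩
    ‖ sigmas fs ‖                      ≡⟨ ‖sigmas‖ ⟩
    3 ℕ.^ suc (suc j) ℕ.* ‖ μ ‖        ≡⟨ cong (3 ℕ.^ suc (suc j) ℕ.*_) ‖μ‖≡m ⟩
    3 ℕ.^ suc (suc j) ℕ.* m            ∎)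
    where
    open ℕP.≤-Reasoning
    3^[1+j]*‖μ‖≡3^e*m : 3 ℕ.^ suc j ℕ.* ‖ μ ‖ ≡ 3 ℕ.^ e ℕ.* m
    3^[1+j]*‖μ‖≡3^e*m = trans (sym ‖powers‖) P≡
    e≡ : suc j ≡ e
    e≡ = p^i*m≡p^j*n⇒i≡j (suc j) e 3^[1+j]*‖μ‖≡3^e*m 3∤‖μ‖ 3∤m
    ‖μ‖≡m : ‖ μ ‖ ≡ m
    ‖μ‖≡m = ℕP.*-cancelˡ-≡ (‖ μ ‖) m (3 ℕ.^ suc j) {{ℕP.m^n≢0 3 (suc j)}}
      (trans 3^[1+j]*‖μ‖≡3^e*m (cong (λ e → 3 ℕ.^ e ℕ.* m) (sym e≡)))
    m≢0 : NonZero m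
    m≢0 = ℕ.≢-nonZero (λ m≡0 → 3∤m (subst (3 ∣_) (sym m≡0) (3 ∣0)))

‖x-1‖≤‖x‖⇒0<Tr : ∀ x → ‖ x -ᴱ 1ᴱ ‖ ≤ ‖ x ‖ → 0ℤ ℤ.< Tr x
‖x-1‖≤‖x‖⇒0<Tr x ‖x-1‖≤‖x‖ =
  ℤP.suc[i]≤j⇒i<j (ℤP.0≤i-j⇒j≤i (subst (0ℤ ℤ.≤_) gap (ℤP.i≤j⇒0≤j-i (+≤+ ‖x-1‖≤‖x‖))))
  where
  open ≡-Reasoning
  gap : + ‖ x ‖ ℤ.- + ‖ x -ᴱ 1ᴱ ‖ ≡ Tr x ℤ.- 1ℤ
  gap = begin
    + ‖ x ‖ ℤ.- + ‖ x -ᴱ 1ᴱ ‖          ≡⟨ cong₂ ℤ._-_ (N≡+‖‖ x) (N≡+‖‖ (x -ᴱ 1ᴱ)) ⟨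
    N x ℤ.- N (x -ᴱ 1ᴱ)                ≡⟨ cong (λ z → N x ℤ.- z) (N[x-1] x) ⟩
    N x ℤ.- (N x ℤ.- Tr x ℤ.+ 1ℤ)      ≡⟨ lemma (N x) (Tr x) ⟩
    Tr x ℤ.- 1ℤ                        ∎
    where
    lemma : ∀ n t → n ℤ.- (n ℤ.- t ℤ.+ 1ℤ) ≡ t ℤ.- 1ℤ
    lemma = solve-∀

fromℤ : ℤ → 𝔼
fromℤ m = m + 0ℤ ω

fromℤ-* : ∀ m n → fromℤ m *ᴱ fromℤ n ≡ fromℤ (m ℤ.* n)
fromℤ-* m n = cong₂ _+_ω (re m n) (im m n)
  where
  re : ∀ m n → m ℤ.* n ℤ.- 0ℤ ℤ.* 0ℤ ≡ m ℤ.* n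
  re = solve-∀
  im : ∀ m n → m ℤ.* 0ℤ ℤ.+ 0ℤ ℤ.* n ℤ.- 0ℤ ℤ.* 0ℤ ≡ 0ℤ
  im = solve-∀

Tr-*-fromℤ : ∀ x m → Tr (x *ᴱ fromℤ m) ≡ m ℤ.* Tr x
Tr-*-fromℤ (a + b ω) m = lemma a b m
  where
  lemma : ∀ a b m → + 2 ℤ.* (a ℤ.* m ℤ.- b ℤ.* 0ℤ) ℤ.- (a ℤ.* 0ℤ ℤ.+ b ℤ.* m ℤ.- b ℤ.* 0ℤ)
                    ≡ m ℤ.* (+ 2 ℤ.* a ℤ.- b)
  lemma = solve-∀

-- λ = √3 e^{iπ/6}, so λ¹² = 3⁶.
λ^[q*12] : ∀ q → λᴱ ^ᴱ (q ℕ.* 12) ≡ fromℤ (+ (729 ℕ.^ q))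
λ^[q*12] zero    = refl
λ^[q*12] (suc q) = begin
  λᴱ ^ᴱ (12 ℕ.+ q ℕ.* 12)                   ≡⟨ ^ᴱ-distribˡ-+-* λᴱ 12 (q ℕ.* 12) ⟩
  λᴱ ^ᴱ 12 *ᴱ λᴱ ^ᴱ (q ℕ.* 12)              ≡⟨ cong (λᴱ ^ᴱ 12 *ᴱ_) (λ^[q*12] q) ⟩
  fromℤ (+ 729) *ᴱ fromℤ (+ (729 ℕ.^ q))    ≡⟨ fromℤ-* (+ 729) (+ (729 ℕ.^ q)) ⟩
  fromℤ (+ 729 ℤ.* + (729 ℕ.^ q))           ≡⟨ cong fromℤ (ℤP.pos-* 729 (729 ℕ.^ q)) ⟨
  fromℤ (+ (729 ℕ.* 729 ℕ.^ q))             ∎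
  where open ≡-Reasoning

0<Tr[λ^k]⇒0<Tr[λ^[k%12]] : ∀ k → 0ℤ ℤ.< Tr (λᴱ ^ᴱ k) → 0ℤ ℤ.< Tr (λᴱ ^ᴱ (k % 12))
0<Tr[λ^k]⇒0<Tr[λ^[k%12]] k 0<Tr[λ^k] =
  ℤP.*-cancelˡ-<-nonNeg c (subst₂ ℤ._<_ (sym (ℤP.*-zeroʳ c)) Tr[λ^k]≡ 0<Tr[λ^k])
  where
  open ≡-Reasoning
  r = k % 12
  q = k / 12
  c = + (729 ℕ.^ q)
  Tr[λ^k]≡ : Tr (λᴱ ^ᴱ k) ≡ c ℤ.* Tr (λᴱ ^ᴱ r)
  Tr[λ^k]≡ = begin
    Tr (λᴱ ^ᴱ k)                         ≡⟨ cong (Tr ∘ (λᴱ ^ᴱ_)) (m≡m%n+[m/n]*n k 12) ⟩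
    Tr (λᴱ ^ᴱ (r ℕ.+ q ℕ.* 12))          ≡⟨ cong Tr (^ᴱ-distribˡ-+-* λᴱ r (q ℕ.* 12)) ⟩
    Tr (λᴱ ^ᴱ r *ᴱ λᴱ ^ᴱ (q ℕ.* 12))     ≡⟨ cong (λ z → Tr (λᴱ ^ᴱ r *ᴱ z)) (λ^[q*12] q) ⟩
    Tr (λᴱ ^ᴱ r *ᴱ fromℤ c)              ≡⟨ Tr-*-fromℤ (λᴱ ^ᴱ r) c ⟩
    c ℤ.* Tr (λᴱ ^ᴱ r)                   ∎

-- Tr(λ^r) = 2·3^(r/2)·cos(rπ/6).
residues : ∀ r → r < 12 → 0ℤ ℤ.< Tr (λᴱ ^ᴱ r) →
  (r ≡ 10) ⊎ (r ≡ 2) ⊎ (r ≡ 11) ⊎ (r ≡ 1) ⊎ (r ≡ 0)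
residues 0  _ _ = inj₂ (inj₂ (inj₂ (inj₂ refl)))
residues 1  _ _ = inj₂ (inj₂ (inj₂ (inj₁ refl)))
residues 2  _ _ = inj₂ (inj₁ refl)
residues 3  _ (+<+ ())
residues 4  _ ()
residues 5  _ ()
residues 6  _ ()
residues 7  _ ()
residues 8  _ ()
residues 9  _ (+<+ ())
residues 10 _ _ = inj₁ refl
residues 11 _ _ = inj₂ (inj₂ (inj₁ refl))
residues (suc (suc (suc (suc (suc (suc (suc (suc (suc (suc (suc (suc r)))))))))))) 12+r<12 _ =
  contradiction 12+r<12 (ℕP.≤⇒≯ (ℕP.m≤m+n 12 r))

mainTheorem6 : (k : ℕ) → (μ : 𝔼) → 2 ≤ k → Odd μ →
    NormPerfect ((λᴱ ^ᴱ (k ∸ 1)) *ᴱ μ) →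
    (k % 12 ≡ 10) ⊎ (k % 12 ≡ 2) ⊎ (k % 12 ≡ 11) ⊎ (k % 12 ≡ 1) ⊎ (k % 12 ≡ 0)
mainTheorem6 k@(suc (suc j)) μ (s≤s (s≤s _)) μ-odd α-perfect =
  residues (k % 12) (m%n<n k 12) (0<Tr[λ^k]⇒0<Tr[λ^[k%12]] k (‖x-1‖≤‖x‖⇒0<Tr (λᴱ ^ᴱ k) ‖λ^k-1‖≤‖λ^k‖))
  where
  ‖λ^k-1‖≤‖λ^k‖ : ‖ λᴱ ^ᴱ k -ᴱ 1ᴱ ‖ ≤ ‖ λᴱ ^ᴱ k ‖
  ‖λ^k-1‖≤‖λ^k‖ = subst (‖ λᴱ ^ᴱ k -ᴱ 1ᴱ ‖ ≤_) (sym (‖‖-^ λᴱ k))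
    (normPerfect⇒‖λ^k-1‖≤3^k j μ (μ-odd ∘ 3∣‖x‖⇒λ∣x μ) α-perfect)
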